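{- Suppose that $\mathcal{H}$ is a cancellative $3$-graph on $n$ vertices. Then \[ |\mathcal{H}|\le\frac{\left(n^2-2|\partial\mathcal{H}|\right)|\partial\mathcal{H}|}{3n}+3n^2. \]
   Context: A $3$-graph $\mathcal{H}$ is a finite vertex set with a set of $3$-element subsets (edges). The shadow is $\partial\mathcal{H}=\{A\in\binom{V(\mathcal{H})}{2}: A\subset B\text{ for some }B\in\mathcal{H}\}$. $\mathcal{T}_3$ is the collection of all $3$-graphs on at most $5$ vertices with $3$ edges $A,B,C$ such that $A\triangle B\subset C$; a $3$-graph is cancellative iff it contains no member of $\mathcal{T}_3$ as a (not necessarily induced) subgraph. -}

module Defs where

open import Data.Nat using (ℕ; zero; suc; _≤_)
open import Data.Fin.Subset using (Subset; inside; outside; ∣_∣; _∪_; _─_; _⊆_)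
open import Data.Fin.Subset.Properties using (_⊆?_)
open import Data.Vec using ([]; _∷_)
open import Data.List using (List; []; _∷_; [_]; map; _++_; filter; length)
open import Data.List.Relation.Unary.Any using (any?)
open import Data.List.Relation.Unary.All using (All)
open import Data.List.Relation.Unary.Unique.Propositional using (Unique)
open import Data.List.Membership.Propositional using (_∈_)
open import Data.Nat using (_≟_)
open import Relation.Nullary using (¬_)
open import Relation.Nullary.Decidable using (_×-dec_)
open import Relation.Binary.PropositionalEquality using (_≡_; _≢_)

record ThreeGraph (n : ℕ) : Set where
  field
    edges      : List (Subset n)
    distinct   : Unique edges
    edges-size : All (λ e → ∣ e ∣ ≡ 3) edges
open ThreeGraph public

size : ∀ {n} → ThreeGraph n → ℕ
size H = length (edges H)

allSubsets : (n : ℕ) → List (Subset n)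
allSubsets zero    = [ [] ]
allSubsets (suc n) = map (inside ∷_) (allSubsets n) ++ map (outside ∷_) (allSubsets n)

shadowSize : ∀ {n} → ThreeGraph n → ℕ
shadowSize {n} H =
  length (filter (λ A → (∣ A ∣ ≟ 2) ×-dec any? (λ B → A ⊆? B) (edges H)) (allSubsets n))

_△_ : ∀ {n} → Subset n → Subset n → Subset n
A △ B = (A ─ B) ∪ (B ─ A)

-- H contains (as a not necessarily induced subgraph) a member of T_3:
-- three distinct edges A, B, C spanning at most 5 vertices with A △ B ⊆ C.
-- Cancellative = contains no such configuration.
Cancellative : ∀ {n} → ThreeGraph n → Set
Cancellative H = ∀ {A B C} → A ∈ edges H → B ∈ edges H → C ∈ edges H →
  A ≢ B → A ≢ C → B ≢ C → ∣ A ∪ B ∪ C ∣ ≤ 5 → ¬ ((A △ B) ⊆ C)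

module Submission where

-- A cancellative 3-graph H on n vertices satisfies 3n·|H| ≤ (n² − 2|∂H|)·|∂H| + 9n³;
-- we prove the sharper 3n·|H| + 2|∂H|² ≤ n²·|∂H| (edge-shadow-bound).
--
-- Let t(w) be the degree of w in the shadow graph and room(w) = n − t(w).  If uvw is an
-- edge, no x can complete {u, v} to another edge and also be a shadow neighbour of w
-- (that is a member of T₃), so codeg(u, v) ≤ room(w).  Give each ordered triple (u, v, w)
-- spanning an edge the weight (room u + room v) / room w.  By AM–GM every edge gets total
-- weight ≥ 6; grouping by the pair (u, v) and using codeg(u, v) ≤ room(w), the total is at
-- most 2 ∑ t(w)·room(w).  Hence 6|H| ≤ ∑ t(w)(n − t(w)); with ∑ t = 2|∂H| and
-- Cauchy–Schwarz this gives the bound.  Fractions are avoided by scaling with K = n!.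

open import Defs

module ShadowBound where

  open import Function using (_∘_)
  open import Data.Empty using (⊥-elim) renaming (⊥ to Empty)
  open import Data.Sum using (_⊎_; inj₁; inj₂)
  open import Data.Product using (Σ-syntax; _×_; _,_)
  open import Data.Bool using (Bool; true; false; not; _∧_)
  open import Data.Nat hiding (_≟_)
  open import Data.Nat using () renaming (_≟_ to _≟ℕ_)
  open import Data.Nat.Properties hiding (_≟_; suc-injective)
  open import Data.Nat.Tactic.RingSolver using (solve-∀)
  open import Data.Nat.DivMod using (_/_; m/n*n≡m; /-monoʳ-≤)
  open import Data.Nat.Divisibility using (∣-trans; m∣m*n; m≤n⇒m!∣n!)
  open import Data.Fin using (Fin; zero; suc)
  open import Data.Fin.Properties using (_≟_; suc-injective)
  open import Data.Fin.Subset using (Subset; inside; outside; ⊥; _∈_; _∉_; _⊆_; _∪_; _─_; _-_; ⁅_⁆; ∣_∣)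
  open import Data.Fin.Subset.Properties
    using (_∈?_; _⊆?_; ⊆-antisym; ∪-comm; drop-there; ∪-identityˡ; ∪-identityʳ; x∈p∪q⁻; x∈p∪q⁺; x∈⁅x⁆; x∈⁅y⁆⇒x≡y; p⊆q⇒∣p∣≤∣q∣; ∣⁅x⁆∣≡1;
           x∈p∧x≢y⇒x∈p-y; x∈p⇒∣p-x∣<∣p∣)
  open import Data.Vec using ([]; _∷_; here; there)
  open import Data.List using (List; []; _∷_; length; map; filter; _++_; lookup)
  open import Data.List.Membership.Propositional using (find; lose) renaming (_∈_ to _∈ᴸ_)
  open import Data.List.Membership.Propositional.Properties using (∈-lookup)
  open import Data.List.Relation.Unary.Any using (any?)
  import Data.List.Relation.Unary.All as All
  open import Data.List.Properties using (map-++; map-∘; map-cong)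
  open import Data.Nat.ListAction using () renaming (sum to sumᴸ)
  open import Data.Nat.ListAction.Properties using () renaming (sum-++ to sumᴸ-++)
  open import Relation.Unary using (Pred; Decidable)
  open import Data.List.Relation.Unary.All using (All; []; _∷_)
  open import Data.List.Relation.Unary.AllPairs using ([]; _∷_)
  open import Data.List.Relation.Unary.Unique.Propositional using (Unique)
  open import Relation.Nullary using (does; yes; no)
  open import Relation.Nullary.Decidable using (_×-dec_)
  open import Relation.Binary.PropositionalEquality
  open import Algebra.Properties.Semiring.Sum +-*-semiring
    using (sum; sum-syntax; sum-cong-≗; ∑-distrib-+; ∑-comm; *-distribˡ-sum; *-distribʳ-sum)

  𝟙 : Bool → ℕ
  𝟙 true  = 1
  𝟙 false = 0

  𝟙≤1 : ∀ b → 𝟙 b ≤ 1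
  𝟙≤1 true  = s≤s z≤n
  𝟙≤1 false = z≤n

  𝟙-∧ : ∀ a b → 𝟙 (a ∧ b) ≡ 𝟙 a * 𝟙 b
  𝟙-∧ true  b = sym (+-identityʳ (𝟙 b))
  𝟙-∧ false b = refl

  ne : ∀ {n} → Fin n → Fin n → ℕ
  ne u v = 𝟙 (not (does (u ≟ v)))

  ne-refl : ∀ {n} (u : Fin n) → ne u u ≡ 0
  ne-refl u with u ≟ u
  ... | yes _  = refl
  ... | no u≢u = ⊥-elim (u≢u refl)

  ne-≢ : ∀ {n} {u v : Fin n} → u ≢ v → ne u v ≡ 1
  ne-≢ {u = u} {v} u≢v with u ≟ v
  ... | yes u≡v = ⊥-elim (u≢v u≡v)
  ... | no _    = refl

  ne-sym : ∀ {n} (u v : Fin n) → ne u v ≡ ne v u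
  ne-sym u v with u ≟ v | v ≟ u
  ... | yes _   | yes _   = refl
  ... | no _    | no _    = refl
  ... | yes u≡v | no v≢u  = ⊥-elim (v≢u (sym u≡v))
  ... | no u≢v  | yes v≡u = ⊥-elim (u≢v (sym v≡u))

  ne≤1 : ∀ {n} (u v : Fin n) → ne u v ≤ 1
  ne≤1 u v = 𝟙≤1 _

  ne-positive : ∀ {n} {u v : Fin n} → 1 ≤ ne u v → u ≢ v
  ne-positive {u = u} pos refl = 1+n≰n (subst (1 ≤_) (ne-refl u) pos)

  ne-guard : ∀ {n} (u v : Fin n) {a b} → (u ≢ v → a ≡ b) → ne u v * a ≡ ne u v * b
  ne-guard u v a≡b with u ≟ v
  ... | yes _   = refl
  ... | no u≢v  = cong (1 *_) (a≡b u≢v)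

  *-positive : ∀ a b → 1 ≤ a * b → 1 ≤ a × 1 ≤ b
  *-positive (suc a) (suc b) _ = s≤s z≤n , s≤s z≤n
  *-positive (suc a) zero    p = ⊥-elim (1+n≰n (subst (1 ≤_) (*-zeroʳ a) p))

  exclusive : ∀ {a b} → a ≤ 1 → b ≤ 1 → (1 ≤ a → 1 ≤ b → Empty) → a + b ≤ 1
  exclusive {zero}  _   b≤1 _    = b≤1
  exclusive {suc _} a≤1 _   both with a≤1
  exclusive {suc _} {zero}  _ _ both | s≤s z≤n = s≤s z≤n
  exclusive {suc _} {suc _} _ _ both | s≤s z≤n = ⊥-elim (both (s≤s z≤n) (s≤s z≤n))

  guarded-*-mono : ∀ a {b c} → (1 ≤ a → b ≤ c) → a * b ≤ a * c
  guarded-*-mono zero    _   = z≤n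
  guarded-*-mono (suc a) b≤c = *-monoʳ-≤ (suc a) (b≤c (s≤s z≤n))

  two-products-≤ : ∀ {a b} → a ≤ b → 2 * (a * b) ≤ a * a + b * b
  two-products-≤ {a} a≤b with m≤n⇒∃[o]m+o≡n a≤b
  ... | k , refl = ≤-trans (m≤m+n _ (k * k)) (≤-reflexive (expand a k))
    where
    expand : ∀ a k → 2 * (a * (a + k)) + k * k ≡ a * a + (a + k) * (a + k)
    expand = solve-∀

  two-products : ∀ a b → 2 * (a * b) ≤ a * a + b * b
  two-products a b with ≤-total a b
  ... | inj₁ a≤b = two-products-≤ a≤b
  ... | inj₂ b≤a = subst₂ _≤_ (cong (2 *_) (*-comm b a)) (+-comm (b * b) (a * a)) (two-products-≤ b≤a)

  -- AM–GM: if X · Y = K² then 2K ≤ X + Y (otherwise (X + Y)² < 4K² = 4XY ≤ (X + Y)²).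
  am-gm : ∀ X Y K → X * Y ≡ K * K → 2 * K ≤ X + Y
  am-gm X Y K XY≡K² with 2 * K ≤? X + Y
  ... | yes 2K≤X+Y = 2K≤X+Y
  ... | no 2K≰X+Y = ⊥-elim (<⇒≱ (*-mono-< small small) (begin
    2 * K * (2 * K)     ≡⟨ four-squares K ⟩
    4 * (K * K)         ≡⟨ cong (4 *_) XY≡K² ⟨
    4 * (X * Y)         ≤⟨ four-products X Y ⟩
    (X + Y) * (X + Y)   ∎))
    where
    open ≤-Reasoning
    small : X + Y < 2 * K
    small = ≰⇒> 2K≰X+Y
    four-squares : ∀ K → 2 * K * (2 * K) ≡ 4 * (K * K)
    four-squares = solve-∀
    four-products : ∀ X Y → 4 * (X * Y) ≤ (X + Y) * (X + Y)
    four-products X Y = begin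
      4 * (X * Y)                       ≡⟨ split X Y ⟩
      2 * (X * Y) + 2 * (X * Y)         ≤⟨ +-monoˡ-≤ (2 * (X * Y)) (two-products X Y) ⟩
      X * X + Y * Y + 2 * (X * Y)       ≡⟨ square X Y ⟩
      (X + Y) * (X + Y)                 ∎
      where
      split : ∀ X Y → 4 * (X * Y) ≡ 2 * (X * Y) + 2 * (X * Y)
      split = solve-∀
      square : ∀ X Y → X * X + Y * Y + 2 * (X * Y) ≡ (X + Y) * (X + Y)
      square = solve-∀

  sum-mono : ∀ {n} {f g : Fin n → ℕ} → (∀ i → f i ≤ g i) → sum f ≤ sum g
  sum-mono {zero}  f≤g = z≤n
  sum-mono {suc n} f≤g = +-mono-≤ (f≤g zero) (sum-mono (f≤g ∘ suc))

  sum-const : ∀ n k → ∑[ i < n ] k ≡ n * k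
  sum-const zero    k = refl
  sum-const (suc n) k = cong (k +_) (sum-const n k)

  sum-zero : ∀ {n} {f : Fin n → ℕ} → (∀ i → f i ≡ 0) → sum f ≡ 0
  sum-zero {n} f≡0 = trans (sum-cong-≗ f≡0) (trans (sum-const n 0) (*-zeroʳ n))

  sum-*ˡ : ∀ {n} k (f : Fin n → ℕ) → ∑[ i < n ] (k * f i) ≡ k * sum f
  sum-*ˡ k f = sym (*-distribˡ-sum k f)

  sum-*ʳ : ∀ {n} (f : Fin n → ℕ) k → ∑[ i < n ] (f i * k) ≡ sum f * k
  sum-*ʳ f k = sym (*-distribʳ-sum k f)

  sum-split : ∀ {n} (a : Fin n) (f : Fin n → ℕ) → sum f ≡ f a + ∑[ i < n ] (ne a i * f i)
  sum-split {suc n} zero    f = cong (f zero +_) (sum-cong-≗ (λ i → sym (+-identityʳ (f (suc i)))))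
  sum-split {suc n} (suc a) f = begin
    f zero + ∑[ i < n ] f (suc i)
      ≡⟨ cong (f zero +_) (sum-split a (f ∘ suc)) ⟩
    f zero + (f (suc a) + ∑[ i < n ] (ne a i * f (suc i)))
      ≡⟨ exchange (f zero) (f (suc a)) (∑[ i < n ] (ne a i * f (suc i))) ⟩
    f (suc a) + (ne (suc a) zero * f zero + ∑[ i < n ] (ne a i * f (suc i)))
      ∎
    where
    open ≡-Reasoning
    exchange : ∀ x y z → x + (y + z) ≡ y + (1 * x + z)
    exchange = solve-∀

  term≤sum : ∀ {n} (f : Fin n → ℕ) a → f a ≤ sum f
  term≤sum {n} f a = ≤-trans (m≤m+n (f a) (∑[ i < n ] (ne a i * f i))) (≤-reflexive (sym (sum-split a f)))

  sum-witness : ∀ {n} (f : Fin n → ℕ) → 1 ≤ sum f → Σ[ i ∈ Fin n ] 1 ≤ f i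
  sum-witness {suc n} f pos with f zero in f₀
  ... | suc _ = zero , subst (1 ≤_) (sym f₀) (s≤s z≤n)
  ... | zero  with sum-witness (f ∘ suc) pos
  ...   | i , fi = suc i , fi

  sum≤1 : ∀ {n} (f : Fin n → ℕ) → (∀ i → f i ≤ 1) →
          (∀ i j → 1 ≤ f i → 1 ≤ f j → i ≡ j) → sum f ≤ 1
  sum≤1 {zero}  f f≤1 unique = z≤n
  sum≤1 {suc n} f f≤1 unique with f zero in f₀
  ... | zero  = sum≤1 (f ∘ suc) (f≤1 ∘ suc) (λ i j fi fj → suc-injective (unique (suc i) (suc j) fi fj))
  ... | suc k = begin
    suc k + ∑[ i < n ] f (suc i)  ≡⟨ cong (suc k +_) (sum-zero rest-zero) ⟩
    suc k + 0                     ≡⟨ +-identityʳ (suc k) ⟩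
    suc k                         ≡⟨ f₀ ⟨
    f zero                        ≤⟨ f≤1 zero ⟩
    1                             ∎
    where
    open ≤-Reasoning
    rest-zero : ∀ i → f (suc i) ≡ 0
    rest-zero i with f (suc i) in fi
    ... | zero  = refl
    ... | suc _ with unique zero (suc i) (subst (1 ≤_) (sym f₀) (s≤s z≤n)) (subst (1 ≤_) (sym fi) (s≤s z≤n))
    ...   | ()

  -- Cauchy–Schwarz in the form (∑ f)² ≤ n · ∑ f²: expand 2(∑ f)² as a double sum
  -- and bound each term 2 f(i) f(j) by f(i)² + f(j)².
  cauchy-schwarz : ∀ {n} (f : Fin n → ℕ) → sum f * sum f ≤ n * ∑[ i < n ] (f i * f i)
  cauchy-schwarz {n} f = *-cancelˡ-≤ 2 (begin
    2 * (sum f * sum f)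
      ≡⟨ cong (2 *_) (sym (sum-*ˡ (sum f) f)) ⟩
    2 * ∑[ j < n ] (sum f * f j)
      ≡⟨ cong (2 *_) (sum-cong-≗ (λ j → trans (*-comm (sum f) (f j)) (sym (sum-*ˡ (f j) f)))) ⟩
    2 * ∑[ j < n ] ∑[ i < n ] (f j * f i)
      ≡⟨ sym (trans (sum-cong-≗ (λ j → sum-*ˡ 2 (λ i → f j * f i))) (sum-*ˡ 2 (λ j → ∑[ i < n ] (f j * f i)))) ⟩
    ∑[ j < n ] ∑[ i < n ] (2 * (f j * f i))
      ≤⟨ sum-mono (λ j → sum-mono (λ i → two-products (f j) (f i))) ⟩
    ∑[ j < n ] ∑[ i < n ] (f j * f j + f i * f i)
      ≡⟨ sum-cong-≗ (λ j → trans (∑-distrib-+ (λ _ → f j * f j) (λ i → f i * f i)) (cong (_+ Q) (sum-const n (f j * f j)))) ⟩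
    ∑[ j < n ] (n * (f j * f j) + Q)
      ≡⟨ trans (∑-distrib-+ (λ j → n * (f j * f j)) (λ _ → Q)) (cong₂ _+_ (sum-*ˡ n (λ j → f j * f j)) (sum-const n Q)) ⟩
    n * Q + n * Q
      ≡⟨ double (n * Q) ⟩
    2 * (n * Q)
      ∎)
    where
    open ≤-Reasoning
    Q = ∑[ i < n ] (f i * f i)
    double : ∀ x → x + x ≡ 2 * x
    double = solve-∀

  sum³-rotate : ∀ {n} (G : Fin n → Fin n → Fin n → ℕ) →
    ∑[ u < n ] ∑[ v < n ] ∑[ w < n ] G v w u ≡ ∑[ u < n ] ∑[ v < n ] ∑[ w < n ] G u v w
  sum³-rotate G = trans (∑-comm (λ u v → ∑[ w < _ ] G v w u)) (sum-cong-≗ (λ v → ∑-comm (λ u w → G v w u)))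

  -- Scaled reciprocals: with K = N!, recip a = K / a is exactly K · (1/a) for
  -- 1 ≤ a ≤ N.  This lets the fractional weighting argument run in ℕ.
  module Reciprocals (N : ℕ) where

    K : ℕ
    K = N !

    recip : ℕ → ℕ
    recip zero    = 0
    recip (suc a) = K / suc a

    recip-exact : ∀ a → 1 ≤ a → a ≤ N → recip a * a ≡ K
    recip-exact (suc a) _ a<N = m/n*n≡m (∣-trans (m∣m*n (a !)) (m≤n⇒m!∣n! a<N))

    recip-antitone : ∀ a b → 1 ≤ a → a ≤ b → recip b ≤ recip a
    recip-antitone (suc a) (suc b) _ a≤b = /-monoʳ-≤ K a≤b

    pair-bound : ∀ a b → 1 ≤ a → a ≤ N → 1 ≤ b → b ≤ N → 2 * K ≤ recip a * b + recip b * a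
    pair-bound a b 1≤a a≤N 1≤b b≤N = am-gm (recip a * b) (recip b * a) K (begin
      recip a * b * (recip b * a)   ≡⟨ regroup (recip a) b (recip b) a ⟩
      recip a * a * (recip b * b)   ≡⟨ cong₂ _*_ (recip-exact a 1≤a a≤N) (recip-exact b 1≤b b≤N) ⟩
      K * K                         ∎)
      where
      open ≡-Reasoning
      regroup : ∀ p b q a → p * b * (q * a) ≡ p * a * (q * b)
      regroup = solve-∀

    triple-bound : ∀ a b c → 1 ≤ a → a ≤ N → 1 ≤ b → b ≤ N → 1 ≤ c → c ≤ N →
      6 * K ≤ recip c * (a + b) + recip a * (b + c) + recip b * (c + a)
    triple-bound a b c 1≤a a≤N 1≤b b≤N 1≤c c≤N = begin
      6 * K
        ≡⟨ six K ⟩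
      2 * K + 2 * K + 2 * K
        ≤⟨ +-mono-≤ (+-mono-≤ (pair-bound c a 1≤c c≤N 1≤a a≤N) (pair-bound c b 1≤c c≤N 1≤b b≤N))
                    (pair-bound a b 1≤a a≤N 1≤b b≤N) ⟩
      recip c * a + recip a * c + (recip c * b + recip b * c) + (recip a * b + recip b * a)
        ≡⟨ regroup (recip a) (recip b) (recip c) a b c ⟩
      recip c * (a + b) + recip a * (b + c) + recip b * (c + a)
        ∎
      where
      open ≤-Reasoning
      six : ∀ K → 6 * K ≡ 2 * K + 2 * K + 2 * K
      six = solve-∀
      regroup : ∀ p q s a b c →
        s * a + p * c + (s * b + q * c) + (p * b + q * a) ≡ s * (a + b) + p * (b + c) + q * (c + a)
      regroup = solve-∀

  χ : ∀ {n} → Subset n → Fin n → ℕ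
  χ e u = 𝟙 (does (u ∈? e))

  χ-∈ : ∀ {n} {e : Subset n} {u} → u ∈ e → χ e u ≡ 1
  χ-∈ {e = e} {u} u∈e with u ∈? e
  ... | yes _   = refl
  ... | no u∉e = ⊥-elim (u∉e u∈e)

  χ-positive : ∀ {n} {e : Subset n} {u} → 1 ≤ χ e u → u ∈ e
  χ-positive {e = e} {u} pos with u ∈? e
  ... | yes u∈e = u∈e

  χ≤1 : ∀ {n} (e : Subset n) u → χ e u ≤ 1
  χ≤1 e u = 𝟙≤1 _

  χ²-positive : ∀ {n} {e : Subset n} {u v} → 1 ≤ χ e u * χ e v → u ∈ e × v ∈ e
  χ²-positive pos = let (u∈ , v∈) = *-positive _ _ pos in χ-positive u∈ , χ-positive v∈

  χ³-positive : ∀ {n} {e : Subset n} {u v w} → 1 ≤ χ e u * χ e v * χ e w → u ∈ e × v ∈ e × w ∈ e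
  χ³-positive pos = let (uv , w∈) = *-positive _ _ pos ; (u∈ , v∈) = χ²-positive uv in u∈ , v∈ , χ-positive w∈

  card-sum : ∀ {n} (e : Subset n) → ∣ e ∣ ≡ sum (χ e)
  card-sum []            = refl
  card-sum (inside  ∷ e) = cong suc (card-sum e)
  card-sum (outside ∷ e) = card-sum e

  card-∪ : ∀ {n} (p q : Subset n) → ∣ p ∪ q ∣ ≤ ∣ p ∣ + ∣ q ∣
  card-∪ []            []            = z≤n
  card-∪ (inside  ∷ p) (inside  ∷ q) = s≤s (≤-trans (card-∪ p q) (+-monoʳ-≤ ∣ p ∣ (n≤1+n ∣ q ∣)))
  card-∪ (inside  ∷ p) (outside ∷ q) = s≤s (card-∪ p q)
  card-∪ (outside ∷ p) (inside  ∷ q) = ≤-trans (s≤s (card-∪ p q)) (≤-reflexive (sym (+-suc ∣ p ∣ ∣ q ∣)))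
  card-∪ (outside ∷ p) (outside ∷ q) = card-∪ p q

  distinct-members : ∀ {n} {p : Subset n} {xs : List (Fin n)} → Unique xs → All (_∈ p) xs → length xs ≤ ∣ p ∣
  distinct-members []                  []            = z≤n
  distinct-members {p = p} (x≢xs ∷ uniq) (x∈p ∷ xs∈p) =
    ≤-trans (s≤s (distinct-members uniq (remaining x≢xs xs∈p))) (x∈p⇒∣p-x∣<∣p∣ x∈p)
    where
    remaining : ∀ {x ys} → All (x ≢_) ys → All (_∈ p) ys → All (_∈ p - x) ys
    remaining []            []            = []
    remaining (x≢y ∷ x≢ys) (y∈p ∷ ys∈p) = x∈p∧x≢y⇒x∈p-y y∈p (≢-sym x≢y) ∷ remaining x≢ys ys∈p

  x∈p─q⁻ : ∀ {n} (p q : Subset n) {x} → x ∈ p ─ q → x ∈ p × x ∉ q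
  x∈p─q⁻ (inside  ∷ p) (outside ∷ q) here        = here , λ ()
  x∈p─q⁻ (inside  ∷ p) (inside  ∷ q) {zero} ()
  x∈p─q⁻ (outside ∷ p) (inside  ∷ q) {zero} ()
  x∈p─q⁻ (outside ∷ p) (outside ∷ q) {zero} ()
  x∈p─q⁻ (_       ∷ p) (_       ∷ q) (there x∈) =
    let (x∈p , x∉q) = x∈p─q⁻ p q x∈ in there x∈p , x∉q ∘ drop-there

  triple-members : ∀ {n} {e : Subset n} {a b c i} → ∣ e ∣ ≡ 3 →
    a ≢ b → a ≢ c → b ≢ c → a ∈ e → b ∈ e → c ∈ e → i ∈ e → i ≡ a ⊎ i ≡ b ⊎ i ≡ c
  triple-members {a = a} {b} {c} {i} ∣e∣≡3 a≢b a≢c b≢c a∈e b∈e c∈e i∈e with i ≟ a | i ≟ b | i ≟ c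
  ... | yes i≡a | _       | _       = inj₁ i≡a
  ... | no _    | yes i≡b | _       = inj₂ (inj₁ i≡b)
  ... | no _    | no _    | yes i≡c = inj₂ (inj₂ i≡c)
  ... | no i≢a  | no i≢b  | no i≢c  =
    ⊥-elim (1+n≰n (subst (4 ≤_) ∣e∣≡3 (distinct-members four-distinct (a∈e ∷ b∈e ∷ c∈e ∷ i∈e ∷ []))))
    where
    four-distinct : Unique (a ∷ b ∷ c ∷ i ∷ [])
    four-distinct = (a≢b ∷ a≢c ∷ ≢-sym i≢a ∷ []) ∷ (b≢c ∷ ≢-sym i≢b ∷ []) ∷ (≢-sym i≢c ∷ []) ∷ [] ∷ []

  outside-triple : ∀ {n} {e : Subset n} {a b c i} → ∣ e ∣ ≡ 3 →
    a ≢ b → a ≢ c → b ≢ c → a ∈ e → b ∈ e → c ∈ e → i ≢ a → i ≢ b → i ≢ c → i ∉ e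
  outside-triple ∣e∣≡3 a≢b a≢c b≢c a∈e b∈e c∈e i≢a i≢b i≢c i∈e
    with triple-members ∣e∣≡3 a≢b a≢c b≢c a∈e b∈e c∈e i∈e
  ... | inj₁ i≡a        = i≢a i≡a
  ... | inj₂ (inj₁ i≡b) = i≢b i≡b
  ... | inj₂ (inj₂ i≡c) = i≢c i≡c

  the-third : ∀ {n} {D : Subset n} {a b c i} → i ≡ a ⊎ i ≡ b ⊎ i ≡ c → a ∈ D → b ∈ D → i ∉ D → i ≡ c
  the-third (inj₁ refl)        a∈D _   i∉D = ⊥-elim (i∉D a∈D)
  the-third (inj₂ (inj₁ refl)) _   b∈D i∉D = ⊥-elim (i∉D b∈D)
  the-third (inj₂ (inj₂ i≡c))  _   _   _   = i≡c

  triple-determines : ∀ {n} {e f : Subset n} {a b c} → ∣ e ∣ ≡ 3 → ∣ f ∣ ≡ 3 →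
    a ≢ b → a ≢ c → b ≢ c → a ∈ e → b ∈ e → c ∈ e → a ∈ f → b ∈ f → c ∈ f → e ≡ f
  triple-determines ∣e∣≡3 ∣f∣≡3 a≢b a≢c b≢c a∈e b∈e c∈e a∈f b∈f c∈f =
    ⊆-antisym (within ∣e∣≡3 a∈e b∈e c∈e a∈f b∈f c∈f) (within ∣f∣≡3 a∈f b∈f c∈f a∈e b∈e c∈e)
    where
    within : ∀ {e f} → ∣ e ∣ ≡ 3 → _ ∈ e → _ ∈ e → _ ∈ e → _ ∈ f → _ ∈ f → _ ∈ f → e ⊆ f
    within ∣e∣≡3 a∈e b∈e c∈e a∈f b∈f c∈f i∈e with triple-members ∣e∣≡3 a≢b a≢c b≢c a∈e b∈e c∈e i∈e
    ... | inj₁ refl        = a∈f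
    ... | inj₂ (inj₁ refl) = b∈f
    ... | inj₂ (inj₂ refl) = c∈f

  others-in-triple : ∀ {n} {e : Subset n} {u} → ∣ e ∣ ≡ 3 → u ∈ e → ∑[ v < n ] (ne u v * χ e v) ≡ 2
  others-in-triple {n} {e} {u} ∣e∣≡3 u∈e = +-cancelˡ-≡ 1 _ _ (begin
    1 + ∑[ v < n ] (ne u v * χ e v)      ≡⟨ cong (_+ ∑[ v < n ] (ne u v * χ e v)) (χ-∈ u∈e) ⟨
    χ e u + ∑[ v < n ] (ne u v * χ e v)  ≡⟨ sum-split u (χ e) ⟨
    sum (χ e)                            ≡⟨ card-sum e ⟨
    ∣ e ∣                                ≡⟨ ∣e∣≡3 ⟩
    3                                    ∎)
    where open ≡-Reasoning

  third-in-triple : ∀ {n} {e : Subset n} {u v} → ∣ e ∣ ≡ 3 → u ≢ v → u ∈ e → v ∈ e →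
    ∑[ x < n ] (ne u x * ne v x * χ e x) ≡ 1
  third-in-triple {n} {e} {u} {v} ∣e∣≡3 u≢v u∈e v∈e = +-cancelˡ-≡ 1 _ _ (begin
    1 + ∑[ x < n ] (ne u x * ne v x * χ e x)
      ≡⟨ cong₂ _+_ (cong₂ _*_ (ne-≢ u≢v) (χ-∈ v∈e)) (sum-cong-≗ (λ x → sym (reorder (ne u x) (ne v x) (χ e x)))) ⟨
    ne u v * χ e v + ∑[ x < n ] (ne v x * (ne u x * χ e x))
      ≡⟨ sum-split v (λ x → ne u x * χ e x) ⟨
    ∑[ x < n ] (ne u x * χ e x)
      ≡⟨ others-in-triple ∣e∣≡3 u∈e ⟩
    2 ∎)
    where
    open ≡-Reasoning
    reorder : ∀ a b c → a * b * c ≡ b * (a * c)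
    reorder = solve-∀

  third-in-triple′ : ∀ {n} {e : Subset n} {u v} → ∣ e ∣ ≡ 3 → u ≢ v →
    χ e u * χ e v * ∑[ x < n ] (ne u x * ne v x * χ e x) ≡ χ e u * χ e v
  third-in-triple′ {e = e} {u} {v} ∣e∣≡3 u≢v with u ∈? e | v ∈? e
  ... | yes u∈e | yes v∈e = cong (1 *_) (third-in-triple ∣e∣≡3 u≢v u∈e v∈e)
  ... | yes _   | no _    = refl
  ... | no _    | _       = refl

  ordered-pairs-in-triple : ∀ {n} {e : Subset n} → ∣ e ∣ ≡ 3 → ∑[ u < n ] ∑[ v < n ] (ne u v * (χ e u * χ e v)) ≡ 6
  ordered-pairs-in-triple {n} {e} ∣e∣≡3 = begin
    ∑[ u < n ] ∑[ v < n ] (ne u v * (χ e u * χ e v))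
      ≡⟨ sum-cong-≗ (λ u → trans (sum-cong-≗ (λ v → regroup (ne u v) (χ e u) (χ e v))) (sum-*ˡ (χ e u) (λ v → ne u v * χ e v))) ⟩
    ∑[ u < n ] (χ e u * ∑[ v < n ] (ne u v * χ e v))
      ≡⟨ sum-cong-≗ companions ⟩
    ∑[ u < n ] (2 * χ e u)
      ≡⟨ sum-*ˡ 2 (χ e) ⟩
    2 * sum (χ e)
      ≡⟨ cong (2 *_) (trans (sym (card-sum e)) ∣e∣≡3) ⟩
    6 ∎
    where
    open ≡-Reasoning
    regroup : ∀ a b c → a * (b * c) ≡ b * (a * c)
    regroup = solve-∀
    companions : ∀ u → χ e u * ∑[ v < n ] (ne u v * χ e v) ≡ 2 * χ e u
    companions u with u ∈? e
    ... | yes u∈e = cong (1 *_) (others-in-triple ∣e∣≡3 u∈e)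
    ... | no _    = refl

  ∑ₛ : ∀ n → (Subset n → ℕ) → ℕ
  ∑ₛ zero    Q = Q []
  ∑ₛ (suc n) Q = ∑ₛ n (λ A → Q (inside ∷ A)) + ∑ₛ n (λ A → Q (outside ∷ A))

  ∑ₛ-allSubsets : ∀ n (Q : Subset n → ℕ) → sumᴸ (map Q (allSubsets n)) ≡ ∑ₛ n Q
  ∑ₛ-allSubsets zero    Q = +-identityʳ (Q [])
  ∑ₛ-allSubsets (suc n) Q = begin
    sumᴸ (map Q (map (inside ∷_) Aₙ ++ map (outside ∷_) Aₙ))
      ≡⟨ cong sumᴸ (map-++ Q (map (inside ∷_) Aₙ) (map (outside ∷_) Aₙ)) ⟩
    sumᴸ (map Q (map (inside ∷_) Aₙ) ++ map Q (map (outside ∷_) Aₙ))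
      ≡⟨ sumᴸ-++ (map Q (map (inside ∷_) Aₙ)) (map Q (map (outside ∷_) Aₙ)) ⟩
    sumᴸ (map Q (map (inside ∷_) Aₙ)) + sumᴸ (map Q (map (outside ∷_) Aₙ))
      ≡⟨ cong₂ _+_ (cong sumᴸ (map-∘ Aₙ)) (cong sumᴸ (map-∘ Aₙ)) ⟨
    sumᴸ (map (λ A → Q (inside ∷ A)) Aₙ) + sumᴸ (map (λ A → Q (outside ∷ A)) Aₙ)
      ≡⟨ cong₂ _+_ (∑ₛ-allSubsets n _) (∑ₛ-allSubsets n _) ⟩
    ∑ₛ (suc n) Q ∎
    where
    open ≡-Reasoning
    Aₙ = allSubsets n

  ∑ₛ-zero : ∀ n → ∑ₛ n (λ _ → 0) ≡ 0
  ∑ₛ-zero zero    = refl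
  ∑ₛ-zero (suc n) = cong₂ _+_ (∑ₛ-zero n) (∑ₛ-zero n)

  length-filter : ∀ {A : Set} {ℓ} {P : Pred A ℓ} (P? : Decidable P) (xs : List A) →
    length (filter P? xs) ≡ sumᴸ (map (λ x → 𝟙 (does (P? x))) xs)
  length-filter P? []       = refl
  length-filter P? (x ∷ xs) with does (P? x)
  ... | true  = cong suc (length-filter P? xs)
  ... | false = length-filter P? xs

  ofSize : ∀ {n} → ℕ → Subset n → ℕ
  ofSize k A = 𝟙 (does (∣ A ∣ ≟ℕ k))

  sum-size0 : ∀ n (Q : Subset n → ℕ) → ∑ₛ n (λ A → ofSize 0 A * Q A) ≡ Q ⊥
  sum-size0 zero    Q = +-identityʳ (Q [])
  sum-size0 (suc n) Q = cong₂ _+_ (∑ₛ-zero n) (sum-size0 n (λ A → Q (outside ∷ A)))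

  sum-size1 : ∀ n (Q : Subset n → ℕ) → ∑ₛ n (λ A → ofSize 1 A * Q A) ≡ ∑[ u < n ] Q ⁅ u ⁆
  sum-size1 zero    Q = refl
  sum-size1 (suc n) Q = cong₂ _+_ (sum-size0 n (λ A → Q (inside ∷ A))) (sum-size1 n (λ A → Q (outside ∷ A)))

  -- Each 2-subset {u, v} arises from exactly two ordered pairs (u, v), (v, u) with u ≢ v.
  sum-size2 : ∀ n (Q : Subset n → ℕ) →
    2 * ∑ₛ n (λ A → ofSize 2 A * Q A) ≡ ∑[ u < n ] ∑[ v < n ] (ne u v * Q (⁅ u ⁆ ∪ ⁅ v ⁆))
  sum-size2 zero    Q = refl
  sum-size2 (suc n) Q = begin
    2 * (X + Y)
      ≡⟨ regroup X Y ⟩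
    X + (X + 2 * Y)
      ≡⟨ cong₂ _+_ (sym pairs-with-zero) (cong₂ _+_ (sym pairs-to-zero) (sum-size2 n (λ A → Q (outside ∷ A)))) ⟩
    ∑[ v < suc n ] (ne zero v * Q (⁅ zero ⁆ ∪ ⁅ v ⁆))
      + (∑[ u < n ] (1 * Q (⁅ suc u ⁆ ∪ ⁅ zero ⁆))
         + ∑[ u < n ] ∑[ v < n ] (ne u v * Q (outside ∷ (⁅ u ⁆ ∪ ⁅ v ⁆))))
      ≡⟨ cong (∑[ v < suc n ] (ne zero v * Q (⁅ zero ⁆ ∪ ⁅ v ⁆)) +_)
              (sym (∑-distrib-+ (λ u → 1 * Q (⁅ suc u ⁆ ∪ ⁅ zero ⁆))
                                (λ u → ∑[ v < n ] (ne u v * Q (outside ∷ (⁅ u ⁆ ∪ ⁅ v ⁆)))))) ⟩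
    ∑[ u < suc n ] ∑[ v < suc n ] (ne u v * Q (⁅ u ⁆ ∪ ⁅ v ⁆))
      ∎
    where
    open ≡-Reasoning
    X = ∑ₛ n (λ A → ofSize 1 A * Q (inside ∷ A))
    Y = ∑ₛ n (λ A → ofSize 2 A * Q (outside ∷ A))
    regroup : ∀ x y → 2 * (x + y) ≡ x + (x + 2 * y)
    regroup = solve-∀
    pairs-with-zero : ∑[ v < suc n ] (ne zero v * Q (⁅ zero ⁆ ∪ ⁅ v ⁆)) ≡ X
    pairs-with-zero = begin
      ne {suc n} zero zero * Q (⁅ zero ⁆ ∪ ⁅ zero ⁆) + ∑[ v < n ] (1 * Q (inside ∷ (⊥ ∪ ⁅ v ⁆)))
        ≡⟨ cong₂ _+_ (cong (_* Q (⁅ zero ⁆ ∪ ⁅ zero ⁆)) (ne-refl {suc n} zero))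
                     (sum-cong-≗ (λ v → trans (*-identityˡ _) (cong (λ A → Q (inside ∷ A)) (∪-identityˡ ⁅ v ⁆)))) ⟩
      ∑[ v < n ] Q (inside ∷ ⁅ v ⁆)
        ≡⟨ sum-size1 n (λ A → Q (inside ∷ A)) ⟨
      X ∎
    pairs-to-zero : ∑[ u < n ] (1 * Q (⁅ suc u ⁆ ∪ ⁅ zero ⁆)) ≡ X
    pairs-to-zero = trans (sum-cong-≗ (λ u → trans (*-identityˡ _) (cong (λ A → Q (inside ∷ A)) (∪-identityʳ ⁅ u ⁆))))
                          (sym (sum-size1 n (λ A → Q (inside ∷ A))))

  lookup-injective : ∀ {A : Set} {xs : List A} → Unique xs → ∀ i j → lookup xs i ≡ lookup xs j → i ≡ j
  lookup-injective (x≢xs ∷ uniq) zero    zero    _  = refl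
  lookup-injective (x≢xs ∷ uniq) zero    (suc j) eq = ⊥-elim (All.lookup x≢xs (∈-lookup j) eq)
  lookup-injective (x≢xs ∷ uniq) (suc i) zero    eq = ⊥-elim (All.lookup x≢xs (∈-lookup i) (sym eq))
  lookup-injective (x≢xs ∷ uniq) (suc i) (suc j) eq = cong suc (lookup-injective uniq i j eq)

  module Quantities {n : ℕ} (H : ThreeGraph n) where

    edge : Fin (size H) → Subset n
    edge = lookup (edges H)

    edge-card : ∀ i → ∣ edge i ∣ ≡ 3
    edge-card i = All.lookup (edges-size H) (∈-lookup i)

    codeg : Fin n → Fin n → ℕ
    codeg u v = ∑[ i < size H ] (χ (edge i) u * χ (edge i) v)

    common : Fin n → Fin n → Fin n → ℕ
    common u v w = ∑[ i < size H ] (χ (edge i) u * χ (edge i) v * χ (edge i) w)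

    codeg-witness : ∀ {u v} → 1 ≤ codeg u v → Σ[ i ∈ Fin (size H) ] (u ∈ edge i × v ∈ edge i)
    codeg-witness {u} {v} pos with sum-witness (λ i → χ (edge i) u * χ (edge i) v) pos
    ... | i , pos-i = i , χ²-positive pos-i

    common-witness : ∀ {u v w} → 1 ≤ common u v w → Σ[ i ∈ Fin (size H) ] (u ∈ edge i × v ∈ edge i × w ∈ edge i)
    common-witness {u} {v} {w} pos with sum-witness (λ i → χ (edge i) u * χ (edge i) v * χ (edge i) w) pos
    ... | i , pos-i = i , χ³-positive pos-i

    common≤1 : ∀ {u v w} → u ≢ v → u ≢ w → v ≢ w → common u v w ≤ 1
    common≤1 {u} {v} {w} u≢v u≢w v≢w = sum≤1 _ term≤1 same-edge
      where
      term≤1 : ∀ i → χ (edge i) u * χ (edge i) v * χ (edge i) w ≤ 1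
      term≤1 i = *-mono-≤ (*-mono-≤ (χ≤1 (edge i) u) (χ≤1 (edge i) v)) (χ≤1 (edge i) w)
      same-edge : ∀ i j → 1 ≤ χ (edge i) u * χ (edge i) v * χ (edge i) w →
                          1 ≤ χ (edge j) u * χ (edge j) v * χ (edge j) w → i ≡ j
      same-edge i j pos-i pos-j with χ³-positive pos-i | χ³-positive pos-j
      ... | u∈i , v∈i , w∈i | u∈j , v∈j , w∈j = lookup-injective (distinct H) i j
        (triple-determines (edge-card i) (edge-card j) u≢v u≢w v≢w u∈i v∈i w∈i u∈j v∈j w∈j)

    codeg-by-third : ∀ {u v} → u ≢ v → ∑[ w < n ] (ne u w * ne v w * common u v w) ≡ codeg u v
    codeg-by-third {u} {v} u≢v = begin
      ∑[ w < n ] (ne u w * ne v w * common u v w)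
        ≡⟨ sum-cong-≗ (λ w → sym (sum-*ˡ (ne u w * ne v w) (λ i → χ (edge i) u * χ (edge i) v * χ (edge i) w))) ⟩
      ∑[ w < n ] ∑[ i < size H ] (ne u w * ne v w * (χ (edge i) u * χ (edge i) v * χ (edge i) w))
        ≡⟨ ∑-comm (λ w i → ne u w * ne v w * (χ (edge i) u * χ (edge i) v * χ (edge i) w)) ⟩
      ∑[ i < size H ] ∑[ w < n ] (ne u w * ne v w * (χ (edge i) u * χ (edge i) v * χ (edge i) w))
        ≡⟨ sum-cong-≗ (λ i → trans (sum-cong-≗ (λ w → regroup (ne u w * ne v w) (χ (edge i) u * χ (edge i) v) (χ (edge i) w)))
                                    (sum-*ˡ (χ (edge i) u * χ (edge i) v) (λ w → ne u w * ne v w * χ (edge i) w))) ⟩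
      ∑[ i < size H ] (χ (edge i) u * χ (edge i) v * ∑[ w < n ] (ne u w * ne v w * χ (edge i) w))
        ≡⟨ sum-cong-≗ (λ i → third-in-triple′ {e = edge i} (edge-card i) u≢v) ⟩
      codeg u v ∎
      where
      open ≡-Reasoning
      regroup : ∀ a b c → a * (b * c) ≡ b * (a * c)
      regroup = solve-∀

    third-term≤1 : ∀ {u v} → u ≢ v → ∀ w → ne u w * ne v w * common u v w ≤ 1
    third-term≤1 {u} {v} u≢v w with u ≟ w | v ≟ w
    ... | yes _   | _       = z≤n
    ... | no _    | yes _   = z≤n
    ... | no u≢w  | no v≢w  = subst (_≤ 1) (sym (+-identityʳ (common u v w))) (common≤1 u≢v u≢w v≢w)

    codeg≤n : ∀ {u v} → u ≢ v → codeg u v ≤ n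
    codeg≤n {u} {v} u≢v = begin
      codeg u v                                        ≡⟨ codeg-by-third u≢v ⟨
      ∑[ w < n ] (ne u w * ne v w * common u v w)      ≤⟨ sum-mono (third-term≤1 u≢v) ⟩
      ∑[ w < n ] 1                                     ≡⟨ trans (sum-const n 1) (*-identityʳ n) ⟩
      n                                                ∎
      where open ≤-Reasoning

    -- Each edge contributes its 6 ordered pairs of distinct vertices.
    ordered-codeg-sum : ∑[ u < n ] ∑[ v < n ] (ne u v * codeg u v) ≡ 6 * size H
    ordered-codeg-sum = begin
      ∑[ u < n ] ∑[ v < n ] (ne u v * codeg u v)
        ≡⟨ sum-cong-≗ (λ u → trans (sum-cong-≗ (λ v → sym (sum-*ˡ (ne u v) (λ i → χ (edge i) u * χ (edge i) v))))
                                    (∑-comm (λ v i → ne u v * (χ (edge i) u * χ (edge i) v)))) ⟩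
      ∑[ u < n ] ∑[ i < size H ] ∑[ v < n ] (ne u v * (χ (edge i) u * χ (edge i) v))
        ≡⟨ ∑-comm (λ u i → ∑[ v < n ] (ne u v * (χ (edge i) u * χ (edge i) v))) ⟩
      ∑[ i < size H ] ∑[ u < n ] ∑[ v < n ] (ne u v * (χ (edge i) u * χ (edge i) v))
        ≡⟨ sum-cong-≗ (λ i → ordered-pairs-in-triple {e = edge i} (edge-card i)) ⟩
      ∑[ i < size H ] 6
        ≡⟨ trans (sum-const (size H) 6) (*-comm (size H) 6) ⟩
      6 * size H ∎
      where open ≡-Reasoning

    inShadow : Subset n → ℕ
    inShadow A = 𝟙 (does (any? (λ B → A ⊆? B) (edges H)))

    adj : Fin n → Fin n → ℕ
    adj u v = inShadow (⁅ u ⁆ ∪ ⁅ v ⁆)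

    shadowDeg : Fin n → ℕ
    shadowDeg u = ∑[ v < n ] (ne u v * adj u v)

    adj-sym : ∀ u v → adj u v ≡ adj v u
    adj-sym u v = cong inShadow (∪-comm ⁅ u ⁆ ⁅ v ⁆)

    adj-intro : ∀ {u v B} → B ∈ᴸ edges H → u ∈ B → v ∈ B → adj u v ≡ 1
    adj-intro {u} {v} {B} B∈H u∈B v∈B with any? (λ B → (⁅ u ⁆ ∪ ⁅ v ⁆) ⊆? B) (edges H)
    ... | yes _      = refl
    ... | no ¬shadow = ⊥-elim (¬shadow (lose B∈H pair⊆B))
      where
      pair⊆B : ⁅ u ⁆ ∪ ⁅ v ⁆ ⊆ B
      pair⊆B x∈ with x∈p∪q⁻ ⁅ u ⁆ ⁅ v ⁆ x∈
      ... | inj₁ x∈⁅u⁆ rewrite x∈⁅y⁆⇒x≡y u x∈⁅u⁆ = u∈B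
      ... | inj₂ x∈⁅v⁆ rewrite x∈⁅y⁆⇒x≡y v x∈⁅v⁆ = v∈B

    adj-elim : ∀ {u v} → 1 ≤ adj u v → Σ[ B ∈ Subset n ] (B ∈ᴸ edges H × u ∈ B × v ∈ B)
    adj-elim {u} {v} pos with any? (λ B → (⁅ u ⁆ ∪ ⁅ v ⁆) ⊆? B) (edges H)
    ... | yes shadow = let (B , B∈H , pair⊆B) = find shadow in
                       B , B∈H , pair⊆B (x∈p∪q⁺ (inj₁ (x∈⁅x⁆ u))) , pair⊆B (x∈p∪q⁺ (inj₂ (x∈⁅x⁆ v)))

    -- Every shadow pair {u, v} is counted by the two ordered pairs (u, v), (v, u).
    shadowDeg-sum : ∑[ u < n ] shadowDeg u ≡ 2 * shadowSize H
    shadowDeg-sum = begin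
      ∑[ u < n ] ∑[ v < n ] (ne u v * inShadow (⁅ u ⁆ ∪ ⁅ v ⁆))
        ≡⟨ sum-size2 n inShadow ⟨
      2 * ∑ₛ n (λ A → ofSize 2 A * inShadow A)
        ≡⟨ cong (2 *_) (∑ₛ-allSubsets n (λ A → ofSize 2 A * inShadow A)) ⟨
      2 * sumᴸ (map (λ A → ofSize 2 A * inShadow A) (allSubsets n))
        ≡⟨ cong (λ xs → 2 * sumᴸ xs) (map-cong (λ A → sym (𝟙-∧ (does (∣ A ∣ ≟ℕ 2)) (does (any? (λ B → A ⊆? B) (edges H))))) (allSubsets n)) ⟩
      2 * sumᴸ (map (λ A → 𝟙 (does (∣ A ∣ ≟ℕ 2) ∧ does (any? (λ B → A ⊆? B) (edges H)))) (allSubsets n))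
        ≡⟨ cong (2 *_) (length-filter (λ A → (∣ A ∣ ≟ℕ 2) ×-dec any? (λ B → A ⊆? B) (edges H)) (allSubsets n)) ⟨
      2 * shadowSize H ∎
      where open ≡-Reasoning

    shadowDeg<n : ∀ u → shadowDeg u < n
    shadowDeg<n u = begin-strict
      shadowDeg u                    ≤⟨ sum-mono (λ v → *-monoʳ-≤ (ne u v) (𝟙≤1 _)) ⟩
      ∑[ v < n ] (ne u v * 1)        <⟨ n<1+n _ ⟩
      1 + ∑[ v < n ] (ne u v * 1)    ≡⟨ sum-split u (λ _ → 1) ⟨
      ∑[ v < n ] 1                   ≡⟨ trans (sum-const n 1) (*-identityʳ n) ⟩
      n                              ∎
      where open ≤-Reasoning

    -- room w = n − shadowDeg w, the number of vertices not adjacent to w in the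
    -- shadow (w itself included); it lies between 1 and n.
    room : Fin n → ℕ
    room w = n ∸ shadowDeg w

    1≤room : ∀ w → 1 ≤ room w
    1≤room w = m<n⇒0<n∸m (shadowDeg<n w)

    room≤n : ∀ w → room w ≤ n
    room≤n w = m∸n≤m n (shadowDeg w)

    room-identity : ∑[ u < n ] (shadowDeg u * room u) + ∑[ u < n ] (shadowDeg u * shadowDeg u)
                    ≡ n * ∑[ u < n ] shadowDeg u
    room-identity = begin
      ∑[ u < n ] (shadowDeg u * room u) + ∑[ u < n ] (shadowDeg u * shadowDeg u)
        ≡⟨ ∑-distrib-+ (λ u → shadowDeg u * room u) (λ u → shadowDeg u * shadowDeg u) ⟨
      ∑[ u < n ] (shadowDeg u * room u + shadowDeg u * shadowDeg u)
        ≡⟨ sum-cong-≗ split ⟩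
      ∑[ u < n ] (n * shadowDeg u)
        ≡⟨ sum-*ˡ n shadowDeg ⟩
      n * ∑[ u < n ] shadowDeg u ∎
      where
      open ≡-Reasoning
      split : ∀ u → shadowDeg u * room u + shadowDeg u * shadowDeg u ≡ n * shadowDeg u
      split u = begin
        shadowDeg u * room u + shadowDeg u * shadowDeg u  ≡⟨ *-distribˡ-+ (shadowDeg u) (room u) (shadowDeg u) ⟨
        shadowDeg u * (n ∸ shadowDeg u + shadowDeg u)    ≡⟨ cong (shadowDeg u *_) (m∸n+n≡m (<⇒≤ (shadowDeg<n u))) ⟩
        shadowDeg u * n                                  ≡⟨ *-comm (shadowDeg u) n ⟩
        n * shadowDeg u                                  ∎

  module UsingCancellativity {n : ℕ} (H : ThreeGraph n) (canc : Cancellative H) where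
    open Quantities H

    -- Edges B ⊇ {u, v, w}, B′ ⊇ {u, v, x} and C ∋ w, x (u, v, w, x distinct) would
    -- form a member of T₃: B △ B′ = {w, x} ⊆ C and B ∪ B′ ∪ C ⊆ {u, v} ∪ C.
    no-T3 : ∀ {B B′ C u v w x} → B ∈ᴸ edges H → B′ ∈ᴸ edges H → C ∈ᴸ edges H →
      u ≢ v → u ≢ w → u ≢ x → v ≢ w → v ≢ x → w ≢ x →
      u ∈ B → v ∈ B → w ∈ B → u ∈ B′ → v ∈ B′ → x ∈ B′ → w ∈ C → x ∈ C → Empty
    no-T3 {B} {B′} {C} {u} {v} {w} {x} B∈H B′∈H C∈H u≢v u≢w u≢x v≢w v≢x w≢x
          u∈B v∈B w∈B u∈B′ v∈B′ x∈B′ w∈C x∈C =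
      canc B∈H B′∈H C∈H B≢B′ B≢C B′≢C five △⊆C
      where
      ∣B∣≡3  = All.lookup (edges-size H) B∈H
      ∣B′∣≡3 = All.lookup (edges-size H) B′∈H
      ∣C∣≡3  = All.lookup (edges-size H) C∈H
      x∉B : x ∉ B
      x∉B = outside-triple ∣B∣≡3 u≢v u≢w v≢w u∈B v∈B w∈B (≢-sym u≢x) (≢-sym v≢x) (≢-sym w≢x)
      w∉B′ : w ∉ B′
      w∉B′ = outside-triple ∣B′∣≡3 u≢v u≢x v≢x u∈B′ v∈B′ x∈B′ (≢-sym u≢w) (≢-sym v≢w) w≢x
      B≢B′ : B ≢ B′
      B≢B′ refl = x∉B x∈B′
      B≢C : B ≢ C
      B≢C refl = x∉B x∈C
      B′≢C : B′ ≢ C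
      B′≢C refl = w∉B′ w∈C
      in-B : ∀ {i} → i ∈ B → i ≡ u ⊎ i ≡ v ⊎ i ≡ w
      in-B = triple-members ∣B∣≡3 u≢v u≢w v≢w u∈B v∈B w∈B
      in-B′ : ∀ {i} → i ∈ B′ → i ≡ u ⊎ i ≡ v ⊎ i ≡ x
      in-B′ = triple-members ∣B′∣≡3 u≢v u≢x v≢x u∈B′ v∈B′ x∈B′
      near : ∀ {i} → i ≡ u ⊎ i ≡ v ⊎ i ∈ C → i ∈ ⁅ u ⁆ ∪ ⁅ v ⁆ ∪ C
      near (inj₁ refl)        = x∈p∪q⁺ (inj₁ (x∈⁅x⁆ u))
      near (inj₂ (inj₁ refl)) = x∈p∪q⁺ (inj₂ (x∈p∪q⁺ (inj₁ (x∈⁅x⁆ v))))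
      near (inj₂ (inj₂ i∈C))  = x∈p∪q⁺ (inj₂ (x∈p∪q⁺ (inj₂ i∈C)))
      via : ∀ {i y} → y ∈ C → i ≡ u ⊎ i ≡ v ⊎ i ≡ y → i ≡ u ⊎ i ≡ v ⊎ i ∈ C
      via y∈C (inj₁ i≡u)        = inj₁ i≡u
      via y∈C (inj₂ (inj₁ i≡v)) = inj₂ (inj₁ i≡v)
      via y∈C (inj₂ (inj₂ refl)) = inj₂ (inj₂ y∈C)
      ⊆uvC : B ∪ B′ ∪ C ⊆ ⁅ u ⁆ ∪ ⁅ v ⁆ ∪ C
      ⊆uvC i∈ with x∈p∪q⁻ B (B′ ∪ C) i∈
      ... | inj₁ i∈B  = near (via w∈C (in-B i∈B))
      ... | inj₂ i∈B′∪C with x∈p∪q⁻ B′ C i∈B′∪C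
      ...   | inj₁ i∈B′ = near (via x∈C (in-B′ i∈B′))
      ...   | inj₂ i∈C  = near (inj₂ (inj₂ i∈C))
      five : ∣ B ∪ B′ ∪ C ∣ ≤ 5
      five = begin
        ∣ B ∪ B′ ∪ C ∣               ≤⟨ p⊆q⇒∣p∣≤∣q∣ ⊆uvC ⟩
        ∣ ⁅ u ⁆ ∪ ⁅ v ⁆ ∪ C ∣        ≤⟨ card-∪ ⁅ u ⁆ (⁅ v ⁆ ∪ C) ⟩
        ∣ ⁅ u ⁆ ∣ + ∣ ⁅ v ⁆ ∪ C ∣    ≤⟨ +-monoʳ-≤ ∣ ⁅ u ⁆ ∣ (card-∪ ⁅ v ⁆ C) ⟩
        ∣ ⁅ u ⁆ ∣ + (∣ ⁅ v ⁆ ∣ + ∣ C ∣)  ≡⟨ cong₂ (λ a b → a + (b + ∣ C ∣)) (∣⁅x⁆∣≡1 u) (∣⁅x⁆∣≡1 v) ⟩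
        1 + (1 + ∣ C ∣)              ≡⟨ cong (λ c → 2 + c) ∣C∣≡3 ⟩
        5                            ∎
        where open ≤-Reasoning
      △⊆C : B △ B′ ⊆ C
      △⊆C i∈ with x∈p∪q⁻ (B ─ B′) (B′ ─ B) i∈
      ... | inj₁ i∈B─B′ = let (i∈B , i∉B′) = x∈p─q⁻ B B′ i∈B─B′ in
                          subst (_∈ C) (sym (the-third (in-B i∈B) u∈B′ v∈B′ i∉B′)) w∈C
      ... | inj₂ i∈B′─B = let (i∈B′ , i∉B) = x∈p─q⁻ B′ B i∈B′─B in
                          subst (_∈ C) (sym (the-third (in-B′ i∈B′) u∈B v∈B i∉B)) x∈C

    -- If u, v, w span an edge, no vertex x completes {u, v} to an edge while being
    -- a shadow neighbour of w (that would be a T₃); so codeg u v + shadowDeg w ≤ n.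
    codeg≤room : ∀ {B u v w} → B ∈ᴸ edges H → u ≢ v → u ≢ w → v ≢ w → u ∈ B → v ∈ B → w ∈ B →
      codeg u v ≤ room w
    codeg≤room {B} {u} {v} {w} B∈H u≢v u≢w v≢w u∈B v∈B w∈B = m+n≤o⇒m≤o∸n (codeg u v) (begin
      codeg u v + shadowDeg w
        ≡⟨ cong (_+ shadowDeg w) (codeg-by-third u≢v) ⟨
      ∑[ x < n ] (ne u x * ne v x * common u v x) + ∑[ x < n ] (ne w x * adj w x)
        ≡⟨ ∑-distrib-+ (λ x → ne u x * ne v x * common u v x) (λ x → ne w x * adj w x) ⟨
      ∑[ x < n ] (ne u x * ne v x * common u v x + ne w x * adj w x)
        ≤⟨ sum-mono (λ x → exclusive (third-term≤1 u≢v x) (*-mono-≤ (ne≤1 w x) (𝟙≤1 _)) (not-both x)) ⟩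
      ∑[ x < n ] 1
        ≡⟨ trans (sum-const n 1) (*-identityʳ n) ⟩
      n ∎)
      where
      open ≤-Reasoning
      not-both : ∀ x → 1 ≤ ne u x * ne v x * common u v x → 1 ≤ ne w x * adj w x → Empty
      not-both x third neighbour with *-positive _ _ third | *-positive _ _ neighbour
      ... | uv≢x , common⁺ | w≢x , adj⁺ with *-positive _ _ uv≢x | common-witness common⁺ | adj-elim adj⁺
      ...   | u≢x , v≢x | i , u∈ , v∈ , x∈ | C , C∈H , w∈C , x∈C =
        no-T3 B∈H (∈-lookup i) C∈H u≢v u≢w (ne-positive u≢x) v≢w (ne-positive v≢x) (ne-positive w≢x)
              u∈B v∈B w∈B u∈ v∈ x∈ w∈C x∈C

    shadow-weighted : ∀ (r : Fin n → ℕ) → ∑[ u < n ] ∑[ v < n ] (ne u v * adj u v * r u) ≡ ∑[ u < n ] (shadowDeg u * r u)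
    shadow-weighted r = sum-cong-≗ (λ u → sum-*ʳ (λ v → ne u v * adj u v) (r u))

    shadow-weighted′ : ∀ (r : Fin n → ℕ) → ∑[ u < n ] ∑[ v < n ] (ne u v * adj u v * r v) ≡ ∑[ v < n ] (shadowDeg v * r v)
    shadow-weighted′ r = begin
      ∑[ u < n ] ∑[ v < n ] (ne u v * adj u v * r v)
        ≡⟨ ∑-comm (λ u v → ne u v * adj u v * r v) ⟩
      ∑[ v < n ] ∑[ u < n ] (ne u v * adj u v * r v)
        ≡⟨ sum-cong-≗ (λ v → sum-cong-≗ (λ u → cong₂ (λ a b → a * b * r v) (ne-sym u v) (adj-sym u v))) ⟩
      ∑[ v < n ] ∑[ u < n ] (ne v u * adj v u * r v)
        ≡⟨ shadow-weighted r ⟩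
      ∑[ v < n ] (shadowDeg v * r v) ∎
      where open ≡-Reasoning

    W : Fin n → Fin n → Fin n → ℕ
    W u v w = ne u v * ne v w * ne w u * common u v w

    W-rotate : ∀ u v w → W v w u ≡ W u v w
    W-rotate u v w = trans (cong (ne v w * ne w u * ne u v *_) common-rotate) (cycle (ne u v) (ne v w) (ne w u) (common u v w))
      where
      common-rotate : common v w u ≡ common u v w
      common-rotate = sum-cong-≗ (λ i → cycle′ (χ (edge i) u) (χ (edge i) v) (χ (edge i) w))
        where
        cycle′ : ∀ a b c → b * c * a ≡ a * b * c
        cycle′ = solve-∀
      cycle : ∀ a b c d → b * c * a * d ≡ a * b * c * d
      cycle = solve-∀

    W-pair : ∀ u v → ∑[ w < n ] W u v w ≡ ne u v * codeg u v
    W-pair u v = begin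
      ∑[ w < n ] W u v w
        ≡⟨ sum-cong-≗ (λ w → trans (cong (λ a → ne u v * ne v w * a * common u v w) (ne-sym w u))
                                  (regroup (ne u v) (ne v w) (ne u w) (common u v w))) ⟩
      ∑[ w < n ] (ne u v * (ne u w * ne v w * common u v w))
        ≡⟨ sum-*ˡ (ne u v) (λ w → ne u w * ne v w * common u v w) ⟩
      ne u v * ∑[ w < n ] (ne u w * ne v w * common u v w)
        ≡⟨ ne-guard u v codeg-by-third ⟩
      ne u v * codeg u v ∎
      where
      open ≡-Reasoning
      regroup : ∀ a b c d → a * b * c * d ≡ a * (c * b * d)
      regroup = solve-∀

    W-total : ∑[ u < n ] ∑[ v < n ] ∑[ w < n ] W u v w ≡ 6 * size H
    W-total = trans (sum-cong-≗ (λ u → sum-cong-≗ (W-pair u))) ordered-codeg-sum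

    W-positive : ∀ {u v w} → 1 ≤ W u v w → 1 ≤ codeg u v × codeg u v ≤ room w
    W-positive {u} {v} {w} pos with *-positive (ne u v * ne v w * ne w u) (common u v w) pos
    ... | distinct , common⁺ with *-positive (ne u v * ne v w) (ne w u) distinct | common-witness {u} {v} {w} common⁺
    ...   | uv≢vw , w≢u | i , u∈ , v∈ , w∈ with *-positive (ne u v) (ne v w) uv≢vw
    ...     | u≢v , v≢w =
      ≤-trans (≤-reflexive (sym (cong₂ _*_ (χ-∈ u∈) (χ-∈ v∈)))) (term≤sum (λ j → χ (edge j) u * χ (edge j) v) i) ,
      codeg≤room (∈-lookup i) (ne-positive u≢v) (≢-sym (ne-positive w≢u)) (ne-positive v≢w) u∈ v∈ w∈

    -- ⟪ F ⟫ sums F over all ordered triples of distinct vertices spanning an edge.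
    ⟪_⟫ : (Fin n → Fin n → Fin n → ℕ) → ℕ
    ⟪ F ⟫ = ∑[ u < n ] ∑[ v < n ] ∑[ w < n ] (W u v w * F u v w)

    ⟪⟫-mono : ∀ {F G} → (∀ u v w → F u v w ≤ G u v w) → ⟪ F ⟫ ≤ ⟪ G ⟫
    ⟪⟫-mono F≤G = sum-mono (λ u → sum-mono (λ v → sum-mono (λ w → *-monoʳ-≤ (W u v w) (F≤G u v w))))

    ⟪⟫-+ : ∀ F G → ⟪ (λ u v w → F u v w + G u v w) ⟫ ≡ ⟪ F ⟫ + ⟪ G ⟫
    ⟪⟫-+ F G = trans (sum-cong-≗ (λ u → trans (sum-cong-≗ (λ v →
        trans (sum-cong-≗ (λ w → *-distribˡ-+ (W u v w) (F u v w) (G u v w)))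
              (∑-distrib-+ (λ w → W u v w * F u v w) (λ w → W u v w * G u v w))))
        (∑-distrib-+ (λ v → ∑[ w < n ] (W u v w * F u v w)) (λ v → ∑[ w < n ] (W u v w * G u v w)))))
      (∑-distrib-+ (λ u → ∑[ v < n ] ∑[ w < n ] (W u v w * F u v w)) (λ u → ∑[ v < n ] ∑[ w < n ] (W u v w * G u v w)))

    ⟪⟫-const : ∀ k → ⟪ (λ _ _ _ → k) ⟫ ≡ k * (6 * size H)
    ⟪⟫-const k = begin
      ∑[ u < n ] ∑[ v < n ] ∑[ w < n ] (W u v w * k)
        ≡⟨ sum-cong-≗ (λ u → trans (sum-cong-≗ (λ v → sum-*ʳ (W u v) k)) (sum-*ʳ (λ v → ∑[ w < n ] W u v w) k)) ⟩
      ∑[ u < n ] (∑[ v < n ] ∑[ w < n ] W u v w * k)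
        ≡⟨ sum-*ʳ (λ u → ∑[ v < n ] ∑[ w < n ] W u v w) k ⟩
      ∑[ u < n ] ∑[ v < n ] ∑[ w < n ] W u v w * k
        ≡⟨ trans (cong (_* k) W-total) (*-comm (6 * size H) k) ⟩
      k * (6 * size H) ∎
      where open ≡-Reasoning

    ⟪⟫-rotate : ∀ F → ⟪ (λ u v w → F v w u) ⟫ ≡ ⟪ F ⟫
    ⟪⟫-rotate F = trans (sum-cong-≗ (λ u → sum-cong-≗ (λ v → sum-cong-≗ (λ w → cong (_* F v w u) (sym (W-rotate u v w))))))
                        (sum³-rotate (λ u v w → W u v w * F u v w))

    open Reciprocals n

    -- The fractional weight (room u + room v) / room w on the triple (u, v, w), scaled by K.
    F : Fin n → Fin n → Fin n → ℕ
    F u v w = recip (room w) * (room u + room v)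

    -- Per edge, AM–GM gives total weight at least 6 over the three rotations.
    ⟪F⟫-lower : 6 * K * (6 * size H) ≤ 3 * ⟪ F ⟫
    ⟪F⟫-lower = begin
      6 * K * (6 * size H)
        ≡⟨ ⟪⟫-const (6 * K) ⟨
      ⟪ (λ _ _ _ → 6 * K) ⟫
        ≤⟨ ⟪⟫-mono (λ u v w → triple-bound (room u) (room v) (room w)
                               (1≤room u) (room≤n u) (1≤room v) (room≤n v) (1≤room w) (room≤n w)) ⟩
      ⟪ (λ u v w → F u v w + F v w u + F w u v) ⟫
        ≡⟨ trans (⟪⟫-+ (λ u v w → F u v w + F v w u) (λ u v w → F w u v))
                 (cong (_+ ⟪ (λ u v w → F w u v) ⟫) (⟪⟫-+ F (λ u v w → F v w u))) ⟩
      ⟪ F ⟫ + ⟪ (λ u v w → F v w u) ⟫ + ⟪ (λ u v w → F w u v) ⟫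
        ≡⟨ cong₂ (λ a b → ⟪ F ⟫ + a + b) (⟪⟫-rotate F) (sym (⟪⟫-rotate (λ a b c → F c a b))) ⟩
      ⟪ F ⟫ + ⟪ F ⟫ + ⟪ F ⟫
        ≡⟨ triple ⟪ F ⟫ ⟩
      3 * ⟪ F ⟫ ∎
      where
      open ≤-Reasoning
      triple : ∀ x → x + x + x ≡ 3 * x
      triple = solve-∀

    -- A positive codegree d contributes d · (K / d) = K, and only on shadow pairs.
    codeg-weight : ∀ u v x → ne u v * codeg u v * (recip (codeg u v) * x) ≤ ne u v * adj u v * (K * x)
    codeg-weight u v x with u ≟ v
    ... | yes _  = z≤n
    ... | no u≢v with codeg u v in codeg≡ | codeg-witness {u} {v} | codeg≤n u≢v
    ...   | zero  | _       | _      = z≤n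
    ...   | suc d | witness | codeg≤ with witness (s≤s z≤n)
    ...     | i , u∈ , v∈ = ≤-reflexive (begin
      1 * suc d * (recip (suc d) * x)    ≡⟨ regroup (suc d) (recip (suc d)) x ⟩
      recip (suc d) * suc d * x          ≡⟨ cong (_* x) (recip-exact (suc d) (s≤s z≤n) codeg≤) ⟩
      K * x                              ≡⟨ *-identityˡ (K * x) ⟨
      1 * (K * x)                        ≡⟨ cong (λ a → 1 * a * (K * x)) (adj-intro (∈-lookup i) u∈ v∈) ⟨
      1 * adj u v * (K * x)              ∎)
      where
      open ≡-Reasoning
      regroup : ∀ d r x → 1 * d * (r * x) ≡ r * d * x
      regroup = solve-∀

    -- For a fixed pair (u, v), every w completing it has room w ≥ codeg u v, so the
    -- weights K / room w sum to at most K.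
    pair-weight : ∀ u v → ∑[ w < n ] (W u v w * F u v w) ≤ ne u v * adj u v * (K * (room u + room v))
    pair-weight u v = begin
      ∑[ w < n ] (W u v w * (recip (room w) * x))
        ≤⟨ sum-mono (λ w → guarded-*-mono (W u v w) (λ pos →
             let (codeg⁺ , codeg≤) = W-positive {u} {v} {w} pos in *-monoˡ-≤ x (recip-antitone _ _ codeg⁺ codeg≤))) ⟩
      ∑[ w < n ] (W u v w * (recip (codeg u v) * x))
        ≡⟨ sum-*ʳ (W u v) (recip (codeg u v) * x) ⟩
      ∑[ w < n ] W u v w * (recip (codeg u v) * x)
        ≡⟨ cong (_* (recip (codeg u v) * x)) (W-pair u v) ⟩
      ne u v * codeg u v * (recip (codeg u v) * x)
        ≤⟨ codeg-weight u v x ⟩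
      ne u v * adj u v * (K * x) ∎
      where
      open ≤-Reasoning
      x = room u + room v

    ⟪F⟫-upper : ⟪ F ⟫ ≤ K * (2 * ∑[ u < n ] (shadowDeg u * room u))
    ⟪F⟫-upper = begin
      ⟪ F ⟫
        ≤⟨ sum-mono (λ u → sum-mono (λ v → pair-weight u v)) ⟩
      ∑[ u < n ] ∑[ v < n ] (ne u v * adj u v * (K * (room u + room v)))
        ≡⟨ sum-cong-≗ (λ u → trans (sum-cong-≗ (λ v → regroup (ne u v * adj u v) K (room u) (room v)))
             (trans (sum-*ˡ K (λ v → ne u v * adj u v * room u + ne u v * adj u v * room v))
                    (cong (K *_) (∑-distrib-+ (λ v → ne u v * adj u v * room u) (λ v → ne u v * adj u v * room v))))) ⟩
      ∑[ u < n ] (K * (∑[ v < n ] (ne u v * adj u v * room u) + ∑[ v < n ] (ne u v * adj u v * room v)))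
        ≡⟨ trans (sum-*ˡ K (λ u → ∑[ v < n ] (ne u v * adj u v * room u) + ∑[ v < n ] (ne u v * adj u v * room v)))
                 (cong (K *_) (∑-distrib-+ (λ u → ∑[ v < n ] (ne u v * adj u v * room u))
                                           (λ u → ∑[ v < n ] (ne u v * adj u v * room v)))) ⟩
      K * (∑[ u < n ] ∑[ v < n ] (ne u v * adj u v * room u) + ∑[ u < n ] ∑[ v < n ] (ne u v * adj u v * room v))
        ≡⟨ cong (K *_) (cong₂ _+_ (shadow-weighted room) (shadow-weighted′ room)) ⟩
      K * (S + S)
        ≡⟨ cong (K *_) (double S) ⟩
      K * (2 * S) ∎
      where
      open ≤-Reasoning
      S = ∑[ u < n ] (shadowDeg u * room u)
      regroup : ∀ a k x y → a * (k * (x + y)) ≡ k * (a * x + a * y)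
      regroup = solve-∀
      double : ∀ x → x + x ≡ 2 * x
      double = solve-∀

    edges≤shadow-room : 6 * size H ≤ ∑[ u < n ] (shadowDeg u * room u)
    edges≤shadow-room = *-cancelˡ-≤ (6 * K) {{Kₙ≢0}} (begin
      6 * K * (6 * size H)   ≤⟨ ⟪F⟫-lower ⟩
      3 * ⟪ F ⟫              ≤⟨ *-monoʳ-≤ 3 ⟪F⟫-upper ⟩
      3 * (K * (2 * S))      ≡⟨ regroup K S ⟩
      6 * K * S              ∎)
      where
      open ≤-Reasoning
      S = ∑[ u < n ] (shadowDeg u * room u)
      Kₙ≢0 : NonZero (6 * K)
      Kₙ≢0 = m*n≢0 6 K {{_}} {{n !≢0}}
      regroup : ∀ k s → 3 * (k * (2 * s)) ≡ 6 * k * s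
      regroup = solve-∀

  edge-shadow-bound : ∀ {n} (H : ThreeGraph n) → Cancellative H →
    3 * n * size H + 2 * shadowSize H * shadowSize H ≤ n * n * shadowSize H
  edge-shadow-bound {n} H canc = *-cancelˡ-≤ 2 (begin
    2 * (3 * n * h + 2 * s * s)      ≡⟨ regroup n h s ⟩
    n * (6 * h) + 2 * s * (2 * s)    ≤⟨ +-mono-≤ (*-monoʳ-≤ n edges≤shadow-room) squares ⟩
    n * S + n * T                    ≡⟨ *-distribˡ-+ n S T ⟨
    n * (S + T)                      ≡⟨ cong (n *_) (trans room-identity (cong (n *_) shadowDeg-sum)) ⟩
    n * (n * (2 * s))                ≡⟨ regroup′ n s ⟩
    2 * (n * n * s)                  ∎)
    where
    open Quantities H
    open UsingCancellativity H canc
    open ≤-Reasoning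
    h = size H
    s = shadowSize H
    S = ∑[ u < n ] (shadowDeg u * room u)
    T = ∑[ u < n ] (shadowDeg u * shadowDeg u)
    squares : 2 * s * (2 * s) ≤ n * T
    squares = subst (λ x → x * x ≤ n * T) shadowDeg-sum (cauchy-schwarz shadowDeg)
    regroup : ∀ n h s → 2 * (3 * n * h + 2 * s * s) ≡ n * (6 * h) + 2 * s * (2 * s)
    regroup = solve-∀
    regroup′ : ∀ n s → n * (n * (2 * s)) ≡ 2 * (n * n * s)
    regroup′ = solve-∀

open ShadowBound using (edge-shadow-bound)

open import Data.Nat as ℕ using (ℕ)
open import Data.Integer using (+_; _-_; _*_; _+_; _≤_; -_; +≤+)
open import Data.Integer.Properties using (pos-+; pos-*; +-monoˡ-≤; i≤i+j; module ≤-Reasoning)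
open import Data.Integer.Tactic.RingSolver using (solve-∀)
open import Relation.Binary.PropositionalEquality using (_≡_; trans; cong; cong₂; subst₂)

integer-form : ∀ n h s → 3 ℕ.* n ℕ.* h ℕ.+ 2 ℕ.* s ℕ.* s ℕ.≤ n ℕ.* n ℕ.* s →
  (+ 3) * (+ n) * (+ h) ≤ ((+ n) * (+ n) - (+ 2) * (+ s)) * (+ s) + (+ 9) * (+ n) * (+ n) * (+ n)
integer-form n h s bound = begin
  (+ 3) * (+ n) * (+ h)
    ≡⟨ add-sub (+ 3 * + n * + h) (+ 2 * + s * + s) ⟩
  (+ 3) * (+ n) * (+ h) + (+ 2) * (+ s) * (+ s) - (+ 2) * (+ s) * (+ s)
    ≤⟨ +-monoˡ-≤ (- ((+ 2) * (+ s) * (+ s))) bound-ℤ ⟩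
  (+ n) * (+ n) * (+ s) - (+ 2) * (+ s) * (+ s)
    ≡⟨ factor (+ n) (+ s) ⟩
  ((+ n) * (+ n) - (+ 2) * (+ s)) * (+ s)
    ≤⟨ i≤i+j (((+ n) * (+ n) - (+ 2) * (+ s)) * (+ s)) (+ (9 ℕ.* n ℕ.* n ℕ.* n)) ⟩
  ((+ n) * (+ n) - (+ 2) * (+ s)) * (+ s) + + (9 ℕ.* n ℕ.* n ℕ.* n)
    ≡⟨ cong (λ c → ((+ n) * (+ n) - (+ 2) * (+ s)) * (+ s) + c) (trans (pos-* (9 ℕ.* n ℕ.* n) n) (cong (_* + n) (cast³ 9 n n))) ⟩
  ((+ n) * (+ n) - (+ 2) * (+ s)) * (+ s) + (+ 9) * (+ n) * (+ n) * (+ n) ∎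
  where
  open ≤-Reasoning
  cast³ : ∀ a b c → + (a ℕ.* b ℕ.* c) ≡ (+ a) * (+ b) * (+ c)
  cast³ a b c = trans (pos-* (a ℕ.* b) c) (cong (_* + c) (pos-* a b))
  bound-ℤ : (+ 3) * (+ n) * (+ h) + (+ 2) * (+ s) * (+ s) ≤ (+ n) * (+ n) * (+ s)
  bound-ℤ = subst₂ _≤_ (trans (pos-+ (3 ℕ.* n ℕ.* h) (2 ℕ.* s ℕ.* s)) (cong₂ _+_ (cast³ 3 n h) (cast³ 2 s s)))
                       (cast³ n n s) (+≤+ bound)
  add-sub : ∀ i j → i ≡ i + j - j
  add-sub = solve-∀
  factor : ∀ n s → n * n * s - + 2 * s * s ≡ (n * n - + 2 * s) * s
  factor = solve-∀

theorem4p6 : (n : ℕ) (H : ThreeGraph n) → Cancellative H →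
    (+ 3) * (+ n) * (+ size H)
      ≤ ((+ n) * (+ n) - (+ 2) * (+ shadowSize H)) * (+ shadowSize H) + (+ 9) * (+ n) * (+ n) * (+ n)
theorem4p6 n H canc = integer-form n (size H) (shadowSize H) (edge-shadow-bound H canc)
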